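{- For all graph classes $\mathcal{G}_1,\dots,\mathcal{G}_d$, $\chi_\star(\mathcal{G}_1\boxtimes\cdots\boxtimes\mathcal{G}_d)\le\prod_{i=1}^d\chi_\star(\mathcal{G}_i)$.
   Context: $\boxtimes$ is the strong product of graphs (vertex set $V(A)\times V(B)$; distinct $(v,x),(w,y)$ adjacent iff ($v=w$, $xy\in E(B)$) or ($x=y$, $vw\in E(A)$) or ($vw\in E(A)$, $xy\in E(B)$)); for classes, $\mathcal{G}_1\boxtimes\cdots\boxtimes\mathcal{G}_d := \{G_1\boxtimes\cdots\boxtimes G_d: G_i\in\mathcal{G}_i\}$. A $k$-colouring has clustering $c$ if every monochromatic connected component has at most $c$ vertices. The clustered chromatic number $\chi_\star(\mathcal{G})$ is the minimum $k$ such that there is $c$ with every graph of $\mathcal{G}$ being $k$-colourable with clustering $c$ ($\infty$ if no such $k$). -}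

module Defs where

open import Level using (0ℓ)
open import Data.Nat using (ℕ; zero; suc; _*_; _≤_)
open import Data.Fin using (Fin; zero; suc; remQuot)
open import Data.Product using (Σ; _×_; _,_; proj₁; proj₂; ∃)
open import Data.Sum using (_⊎_; inj₁; inj₂)
open import Data.Empty using (⊥)
open import Relation.Nullary using (¬_)
open import Relation.Binary.PropositionalEquality using (_≡_; refl; sym)
open import Relation.Binary.Construct.Closure.ReflexiveTransitive using (Star)
open import Function.Definitions using (Injective)

record Graph : Set₁ where
  field
    n     : ℕ
    adj   : Fin n → Fin n → Set
    adj-sym : ∀ {u v} → adj u v → adj v u
    irref : ∀ {u} → ¬ adj u u
open Graph public

GraphClass : Set₂
GraphClass = Graph → Set₁

-- Strong product A ⊠ B, vertex set Fin (n A * n B) ≅ Fin (n A) × Fin (n B) via remQuot.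
module _ (A B : Graph) where
  private
    pair : Fin (n A * n B) → Fin (n A) × Fin (n B)
    pair = remQuot {n A} (n B)

    sadj : Fin (n A * n B) → Fin (n A * n B) → Set
    sadj u w with pair u | pair w
    ... | (v , x) | (w' , y) =
      ((v ≡ w') × adj B x y) ⊎ ((x ≡ y) × adj A v w') ⊎ (adj A v w' × adj B x y)

    ssym : ∀ {u w} → sadj u w → sadj w u
    ssym {u} {w} p with pair u | pair w
    ... | (v , x) | (w' , y) with p
    ... | inj₁ (e , q) = inj₁ (sym e , adj-sym B q)
    ... | inj₂ (inj₁ (e , q)) = inj₂ (inj₁ (sym e , adj-sym A q))
    ... | inj₂ (inj₂ (q , r)) = inj₂ (inj₂ (adj-sym A q , adj-sym B r))

    sirr : ∀ {u} → ¬ sadj u u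
    sirr {u} p with pair u
    ... | (v , x) with p
    ... | inj₁ (_ , q) = irref B q
    ... | inj₂ (inj₁ (_ , q)) = irref A q
    ... | inj₂ (inj₂ (q , _)) = irref A q

  _⊠_ : Graph
  _⊠_ = record { n = n A * n B ; adj = sadj ; adj-sym = ssym ; irref = sirr }

⊠-prod : ∀ {d} → (Fin (suc d) → Graph) → Graph
⊠-prod {zero}  Gs = Gs zero
⊠-prod {suc d} Gs = Gs zero ⊠ ⊠-prod (λ i → Gs (suc i))

⊠-class : ∀ {d} → (Fin (suc d) → GraphClass) → GraphClass
⊠-class {d} 𝒢s H = Σ (Fin (suc d) → Graph) λ Gs → (∀ i → 𝒢s i (Gs i)) × (H ≡ ⊠-prod Gs)

∏ : ∀ {d} → (Fin (suc d) → ℕ) → ℕ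
∏ {zero}  ks = ks zero
∏ {suc d} ks = ks zero * ∏ (λ i → ks (suc i))

MonoEdge : (G : Graph) {k : ℕ} → (Fin (n G) → Fin k) → Fin (n G) → Fin (n G) → Set
MonoEdge G f u v = adj G u v × (f u ≡ f v)

SameComp : (G : Graph) {k : ℕ} → (Fin (n G) → Fin k) → Fin (n G) → Fin (n G) → Set
SameComp G f = Star (MonoEdge G f)

-- The colouring f has clustering c: every monochromatic component has at most c vertices,
-- i.e. any m distinct vertices in the component of v satisfy m ≤ c.
HasClustering : (G : Graph) {k : ℕ} → (Fin (n G) → Fin k) → ℕ → Set
HasClustering G f c =
  ∀ (v : Fin (n G)) (m : ℕ) (g : Fin m → Fin (n G)) →
    Injective _≡_ _≡_ g → (∀ i → SameComp G f v (g i)) → m ≤ c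

ClColourable : Graph → ℕ → ℕ → Set
ClColourable G k c = Σ (Fin (n G) → Fin k) λ f → HasClustering G f c

χ★≤ : GraphClass → ℕ → Set₁
χ★≤ 𝒢 k = ∃ λ (c : ℕ) → ∀ G → 𝒢 G → ClColourable G k c

-- Colour each factor Gᵢ with kᵢ colours and clustering cᵢ, and colour a vertex (v₁, …, v_d) of the
-- product by the tuple of the colours of its coordinates. Along a monochromatic edge of the product
-- every coordinate stays put or moves along a monochromatic edge of its factor, so a monochromatic
-- component of the product projects into a monochromatic component of each factor and hence embeds
-- into a product of sets of sizes at most c₁, …, c_d. It suffices to treat two factors and induct.
module Submission where

open import Defs
open import Data.Nat using (ℕ; suc; zero; _*_; _≤_)
open import Data.Nat.Properties using (*-mono-≤; ≤-trans)
open import Data.Fin using (Fin; zero; suc; remQuot; combine)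
open import Data.Fin.Properties using (combine-remQuot; combine-injective; injective⇒≤; any?; _≟_)
open import Data.Product using (_×_; _,_; proj₁; proj₂; ∃)
open import Data.Sum using (inj₁; inj₂)
open import Data.Empty using (⊥-elim)
open import Relation.Nullary using (yes; no)
open import Relation.Binary.PropositionalEquality using (_≡_; refl; sym; trans; cong; cong₂; subst)
open import Relation.Binary.Construct.Closure.ReflexiveTransitive using (ε; _◅_; kleisliStar)
open import Function.Definitions using (Injective)

record Image {m N : ℕ} (h : Fin m → Fin N) : Set where
  field
    size           : ℕ
    enum           : Fin size → Fin N
    enum-injective : Injective _≡_ _≡_ enum
    index          : Fin m → Fin size
    enum∘index     : ∀ i → enum (index i) ≡ h i
    enum-covered   : ∀ j → ∃ λ i → enum j ≡ h i

  index-reflects : ∀ {i j} → index i ≡ index j → h i ≡ h j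
  index-reflects {i} {j} eq = trans (sym (enum∘index i)) (trans (cong enum eq) (enum∘index j))

image : ∀ {m N} (h : Fin m → Fin N) → Image h
image {zero} h = record
  { size = 0 ; enum = λ () ; enum-injective = λ {x} → λ { {()} }
  ; index = λ () ; enum∘index = λ () ; enum-covered = λ () }
image {suc m} h with image (λ i → h (suc i))
... | I with any? (λ j → Image.enum I j ≟ h zero)
...   | yes (j , enum-j≡h0) = record
  { size = size ; enum = enum ; enum-injective = enum-injective
  ; index = index′ ; enum∘index = enum∘index′ ; enum-covered = enum-covered′ }
  where
    open Image I
    index′ : Fin (suc m) → Fin size
    index′ zero    = j
    index′ (suc i) = index i
    enum∘index′ : ∀ i → enum (index′ i) ≡ h i
    enum∘index′ zero    = enum-j≡h0
    enum∘index′ (suc i) = enum∘index i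
    enum-covered′ : ∀ j → ∃ λ i → enum j ≡ h i
    enum-covered′ j = let i , eq = enum-covered j in suc i , eq
...   | no h0∉enum = record
  { size = suc size ; enum = enum′ ; enum-injective = enum′-injective
  ; index = index′ ; enum∘index = enum∘index′ ; enum-covered = enum-covered′ }
  where
    open Image I
    enum′ : Fin (suc size) → Fin _
    enum′ zero    = h zero
    enum′ (suc j) = enum j
    enum′-injective : Injective _≡_ _≡_ enum′
    enum′-injective {zero}  {zero}  _  = refl
    enum′-injective {zero}  {suc y} eq = ⊥-elim (h0∉enum (y , sym eq))
    enum′-injective {suc x} {zero}  eq = ⊥-elim (h0∉enum (x , eq))
    enum′-injective {suc x} {suc y} eq = cong suc (enum-injective eq)
    index′ : Fin (suc m) → Fin (suc size)
    index′ zero    = zero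
    index′ (suc i) = suc (index i)
    enum∘index′ : ∀ i → enum′ (index′ i) ≡ h i
    enum∘index′ zero    = refl
    enum∘index′ (suc i) = enum∘index i
    enum-covered′ : ∀ j → ∃ λ i → enum′ j ≡ h i
    enum-covered′ zero    = zero , refl
    enum-covered′ (suc j) = let i , eq = enum-covered j in suc i , eq

≤-*-image-sizes : ∀ {m N₁ N₂} (a : Fin m → Fin N₁) (b : Fin m → Fin N₂) →
  (∀ {i j} → a i ≡ a j → b i ≡ b j → i ≡ j) →
  m ≤ Image.size (image a) * Image.size (image b)
≤-*-image-sizes a b separates = injective⇒≤ pairIndex-injective
  where
    module IA = Image (image a)
    module IB = Image (image b)
    pairIndex-injective : Injective _≡_ _≡_ (λ i → combine (IA.index i) (IB.index i))
    pairIndex-injective eq =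
      let eqA , eqB = combine-injective _ _ _ _ eq
      in separates (IA.index-reflects eqA) (IB.index-reflects eqB)

image-size≤clustering : ∀ (G : Graph) {k c m} {f : Fin (n G) → Fin k} → HasClustering G f c →
  ∀ v (h : Fin m → Fin (n G)) → (∀ i → SameComp G f v (h i)) → Image.size (image h) ≤ c
image-size≤clustering G {f = f} clustered v h inComp =
  clustered v size enum enum-injective λ j →
    let i , eq = enum-covered j in subst (SameComp G f v) (sym eq) (inComp i)
  where open Image (image h)

module ProductColouring (A B : Graph) {k₁ k₂ : ℕ} (f : Fin (n A) → Fin k₁) (g : Fin (n B) → Fin k₂) where

  π₁ : Fin (n (A ⊠ B)) → Fin (n A)
  π₁ u = proj₁ (remQuot {n A} (n B) u)

  π₂ : Fin (n (A ⊠ B)) → Fin (n B)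
  π₂ u = proj₂ (remQuot {n A} (n B) u)

  colour : Fin (n (A ⊠ B)) → Fin (k₁ * k₂)
  colour u = combine (f (π₁ u)) (g (π₂ u))

  colour-injective : ∀ {u w} → colour u ≡ colour w → f (π₁ u) ≡ f (π₁ w) × g (π₂ u) ≡ g (π₂ w)
  colour-injective = combine-injective _ _ _ _

  monoEdge⇒sameComp₁ : ∀ {u w} → MonoEdge (A ⊠ B) colour u w → SameComp A f (π₁ u) (π₁ w)
  monoEdge⇒sameComp₁ {u} (uw , same) with colour-injective same | uw
  ... | sameA , _ | inj₁ (π₁u≡π₁w , _)  = subst (SameComp A f (π₁ u)) π₁u≡π₁w ε
  ... | sameA , _ | inj₂ (inj₁ (_ , e)) = (e , sameA) ◅ ε
  ... | sameA , _ | inj₂ (inj₂ (e , _)) = (e , sameA) ◅ ε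

  monoEdge⇒sameComp₂ : ∀ {u w} → MonoEdge (A ⊠ B) colour u w → SameComp B g (π₂ u) (π₂ w)
  monoEdge⇒sameComp₂ {u} (uw , same) with colour-injective same | uw
  ... | _ , sameB | inj₁ (_ , e)              = (e , sameB) ◅ ε
  ... | _ , sameB | inj₂ (inj₁ (π₂u≡π₂w , _)) = subst (SameComp B g (π₂ u)) π₂u≡π₂w ε
  ... | _ , sameB | inj₂ (inj₂ (_ , e))       = (e , sameB) ◅ ε

  sameComp₁ : ∀ {u w} → SameComp (A ⊠ B) colour u w → SameComp A f (π₁ u) (π₁ w)
  sameComp₁ = kleisliStar π₁ monoEdge⇒sameComp₁

  sameComp₂ : ∀ {u w} → SameComp (A ⊠ B) colour u w → SameComp B g (π₂ u) (π₂ w)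
  sameComp₂ = kleisliStar π₂ monoEdge⇒sameComp₂

  π-separates : ∀ {u w} → π₁ u ≡ π₁ w → π₂ u ≡ π₂ w → u ≡ w
  π-separates {u} {w} e₁ e₂ =
    trans (sym (combine-remQuot {n A} (n B) u))
          (trans (cong₂ combine e₁ e₂) (combine-remQuot {n A} (n B) w))

  colour-clustering : ∀ {c₁ c₂} → HasClustering A f c₁ → HasClustering B g c₂ →
    HasClustering (A ⊠ B) colour (c₁ * c₂)
  colour-clustering clustered₁ clustered₂ v m γ γ-injective inComp =
    ≤-trans (≤-*-image-sizes (λ i → π₁ (γ i)) (λ i → π₂ (γ i))
                             (λ e₁ e₂ → γ-injective (π-separates e₁ e₂)))
            (*-mono-≤ (image-size≤clustering A clustered₁ (π₁ v) _ (λ i → sameComp₁ (inComp i)))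
                      (image-size≤clustering B clustered₂ (π₂ v) _ (λ i → sameComp₂ (inComp i))))

⊠-clColourable : ∀ A B {k₁ k₂ c₁ c₂} → ClColourable A k₁ c₁ → ClColourable B k₂ c₂ →
  ClColourable (A ⊠ B) (k₁ * k₂) (c₁ * c₂)
⊠-clColourable A B (f , clustered₁) (g , clustered₂) =
  colour , colour-clustering clustered₁ clustered₂
  where open ProductColouring A B f g

⊠-prod-clColourable : ∀ d (Gs : Fin (suc d) → Graph) (ks cs : Fin (suc d) → ℕ) →
  (∀ i → ClColourable (Gs i) (ks i) (cs i)) → ClColourable (⊠-prod Gs) (∏ ks) (∏ cs)
⊠-prod-clColourable zero    Gs ks cs col = col zero
⊠-prod-clColourable (suc d) Gs ks cs col =
  ⊠-clColourable (Gs zero) (⊠-prod (λ i → Gs (suc i))) (col zero)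
    (⊠-prod-clColourable d (λ i → Gs (suc i)) (λ i → ks (suc i)) (λ i → cs (suc i)) (λ i → col (suc i)))

mainTheorem5 : (d : ℕ) (𝒢s : Fin (suc d) → GraphClass) (ks : Fin (suc d) → ℕ) →
    (∀ i → χ★≤ (𝒢s i) (ks i)) → χ★≤ (⊠-class 𝒢s) (∏ ks)
mainTheorem5 d 𝒢s ks χ★-bounds = ∏ clusterings , colourable
  where
    clusterings : Fin (suc d) → ℕ
    clusterings i = proj₁ (χ★-bounds i)
    colourable : ∀ G → ⊠-class 𝒢s G → ClColourable G (∏ ks) (∏ clusterings)
    colourable G (Gs , Gs∈𝒢s , refl) =
      ⊠-prod-clColourable d Gs ks clusterings (λ i → proj₂ (χ★-bounds i) (Gs i) (Gs∈𝒢s i))
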